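{- GAF properly contains the Ackermann fragment and the monadic first-order fragment, both without equality and without non-constant function symbols; that is, every such Ackermann sentence and every such monadic sentence (in standard form) belongs to GAF, and there are GAF sentences belonging to neither.
   Context: A first-order sentence $\varphi$ is in standard form if $\varphi = \forall \vec{x}_1 \exists \vec{y}_1 \ldots \forall \vec{x}_n \exists \vec{y}_n.\,\psi$, where the $\vec{x}_i,\vec{y}_i$ are tuples of variables ($\vec{x}_1$ and $\vec{y}_n$ may be empty), $\psi$ is quantifier-free, in negation normal form and uses only $\wedge,\vee,\neg$, every variable bound in the prefix occurs in $\psi$, and no variable is bound twice. Let $\vec{x}:=\bigcup_i\vec{x}_i$, $\vec{y}:=\bigcup_i\vec{y}_i$, $\mathrm{At}$ the set of atoms, $\mathrm{vars}(S)$ the set of variables occurring in a set $S$ of atoms, and $\mathrm{idx}(v):=k$ iff $v\in\vec{x}_k$ or $v\in\vec{y}_k$. A sentence in standard form without equality and without non-constant function symbols belongs to GAF iff $\mathrm{At}$ can be partitioned into sets $\mathrm{At}_0$ and $\mathrm{At}_x$, $x\in\vec{x}$, such that (a) $\mathrm{vars}(\mathrm{At}_0)\cap\vec{x}=\emptyset$; (b) for every $x\in\vec{x}$, $\mathrm{vars}(\mathrm{At}_x)\cap\vec{x}=\{x\}$; (c) for every $y\in\vec{y}$ occurring in some $\mathrm{At}_x$, exactly one of: (c.1) for every $\mathrm{At}_x$ in which $y$ occurs, $\mathrm{idx}(y)<\mathrm{idx}(x)$; or (c.2) there is exactly one $\mathrm{At}_x$ in which $y$ occurs, $y$ does not occur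 in $\mathrm{At}_0$, and $\mathrm{idx}(y)\ge\mathrm{idx}(x)$. The Ackermann fragment consists of sentences of the form $\exists\vec{y}\,\forall x\,\exists\vec{z}.\,\psi'$ with $\psi'$ quantifier-free. The monadic fragment consists of sentences in which all predicate symbols are unary. -}

module Defs where

open import Data.Nat using (ℕ; zero; suc; _<_; _≤_; _≡ᵇ_)
open import Data.Bool using (Bool; true; false; if_then_else_)
open import Data.List using (List; []; _∷_; _++_; concatMap; map; length)
open import Data.List.Membership.Propositional using (_∈_; _∉_)
open import Data.List.Relation.Unary.Unique.Propositional using (Unique)
open import Data.List.Relation.Unary.All using (All)
open import Data.Maybe using (Maybe; just; nothing)
open import Data.Vec using (Vec; toList)
open import Data.Product using (Σ; _×_; _,_; proj₁; proj₂)
open import Data.Sum using (_⊎_)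
open import Data.Unit using (⊤)
open import Data.Empty using (⊥)
open import Relation.Nullary using (¬_)
open import Relation.Binary.PropositionalEquality using (_≡_; _≢_)

Var : Set
Var = ℕ

data Term : Set where
  var : Var → Term
  cst : ℕ → Term

record PredSym : Set where
  constructor pred
  field
    name  : ℕ
    arity : ℕ

record Atom : Set where
  constructor atom
  field
    sym  : PredSym
    args : Vec Term (PredSym.arity sym)

data QF : Set where
  lit  : Bool → Atom → QF   -- lit true A = A ,  lit false A = ¬ A
  _∧ᶠ_ : QF → QF → QF
  _∨ᶠ_ : QF → QF → QF

termVars : Term → List Var
termVars (var v) = v ∷ []
termVars (cst _) = []

atomVars : Atom → List Var
atomVars (atom _ as) = concatMap termVars (toList as)

-- the atoms occurring in a quantifier-free formula (the set At, as a list)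
atoms : QF → List Atom
atoms (lit _ a) = a ∷ []
atoms (φ ∧ᶠ ψ) = atoms φ ++ atoms ψ
atoms (φ ∨ᶠ ψ) = atoms φ ++ atoms ψ

qfVars : QF → List Var
qfVars φ = concatMap atomVars (atoms φ)

-- Prenex sentences  ∀x⃗₁ ∃y⃗₁ … ∀x⃗ₙ ∃y⃗ₙ. ψ
-- A block (x⃗ᵢ , y⃗ᵢ); the prefix is the list of blocks 1..n.

Block : Set
Block = List Var × List Var

record Sentence : Set where
  constructor sentence
  field
    prefix : List Block
    matrix : QF

univVars : List Block → List Var
univVars = concatMap proj₁

existVars : List Block → List Var
existVars = concatMap proj₂

boundVars : List Block → List Var
boundVars = concatMap (λ b → proj₁ b ++ proj₂ b)

private
  elem : Var → List Var → Bool
  elem v [] = false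
  elem v (w ∷ ws) = if v ≡ᵇ w then true else elem v ws

  idxFrom : ℕ → List Block → Var → ℕ
  idxFrom k [] v = 0
  idxFrom k ((xs , ys) ∷ bs) v =
    if elem v (xs ++ ys) then k else idxFrom (suc k) bs v

-- idx(v) = k iff v ∈ x⃗ₖ or v ∈ y⃗ₖ  (blocks numbered from 1)
idx : List Block → Var → ℕ
idx = idxFrom 1

-- Only x⃗₁ and y⃗ₙ may be empty, and n ≥ 1.
private
  LaterBlocksOK : List Block → Set
  LaterBlocksOK [] = ⊤
  LaterBlocksOK ((xs , ys) ∷ []) = xs ≢ []
  LaterBlocksOK ((xs , ys) ∷ b ∷ bs) = xs ≢ [] × ys ≢ [] × LaterBlocksOK (b ∷ bs)

BlocksOK : List Block → Set
BlocksOK [] = ⊥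
BlocksOK ((xs , ys) ∷ []) = ⊤
BlocksOK ((xs , ys) ∷ b ∷ bs) = ys ≢ [] × LaterBlocksOK (b ∷ bs)

StandardForm : Sentence → Set
StandardForm (sentence pre ψ) =
  BlocksOK pre ×
  Unique (boundVars pre) ×
  All (λ v → v ∈ qfVars ψ) (boundVars pre) ×
  All (λ v → v ∈ boundVars pre) (qfVars ψ)

-- GAF.  A partition of At into At₀ and Atₓ (x ∈ x⃗) is given by a labelling
-- f : Atom → Maybe Var  (nothing ↦ At₀, just x ↦ Atₓ) on the atoms of ψ.

module _ (φ : Sentence) (f : Atom → Maybe Var) where
  open Sentence φ

  X Y : List Var
  X = univVars prefix
  Y = existVars prefix

  InAt : Var → Var → Set
  InAt x v = Σ Atom λ a → a ∈ atoms matrix × f a ≡ just x × v ∈ atomVars a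

  InAt₀ : Var → Set
  InAt₀ v = Σ Atom λ a → a ∈ atoms matrix × f a ≡ nothing × v ∈ atomVars a

  LabelsOK : Set
  LabelsOK = ∀ a x → a ∈ atoms matrix → f a ≡ just x → x ∈ X

  CondA : Set
  CondA = ∀ v → InAt₀ v → v ∉ X

  CondB : Set
  CondB = ∀ x → x ∈ X → InAt x x × (∀ v → InAt x v → v ∈ X → v ≡ x)

  C1 : Var → Set
  C1 y = ∀ x → x ∈ X → InAt x y → idx prefix y < idx prefix x

  C2 : Var → Set
  C2 y = Σ Var λ x → x ∈ X × InAt x y × (∀ x′ → x′ ∈ X → InAt x′ y → x′ ≡ x)
           × ¬ InAt₀ y × idx prefix x ≤ idx prefix y

  CondC : Set
  CondC = ∀ y → y ∈ Y → (Σ Var λ x → x ∈ X × InAt x y) →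
            (C1 y ⊎ C2 y) × ¬ (C1 y × C2 y)

GAF : Sentence → Set
GAF φ = StandardForm φ × Σ (Atom → Maybe Var) λ f →
          LabelsOK φ f × CondA φ f × CondB φ f × CondC φ f

-- Ackermann fragment: ∃y⃗ ∀x ∃z⃗. ψ′  (in standard form: either the blocks
-- ([] , y⃗) , ([x] , z⃗), or, when y⃗ is empty, the single block ([x] , z⃗)).
Ackermann : Sentence → Set
Ackermann (sentence pre ψ) =
  Σ (List Var) λ ys → Σ Var λ x → Σ (List Var) λ zs →
    (pre ≡ ([] , ys) ∷ (x ∷ [] , zs) ∷ []) ⊎ (pre ≡ (x ∷ [] , zs) ∷ [])

Monadic : Sentence → Set
Monadic (sentence pre ψ) = All (λ a → PredSym.arity (Atom.sym a) ≡ 1) (atoms ψ)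

-- With a single universal variable x, put every atom into Atₓ: conditions (a) and (b)
-- are then immediate, and an existential variable y satisfies (c.1) if idx y < idx x
-- and (c.2) otherwise.  If instead no atom contains two distinct variables, put each
-- atom into Atₓ for the universal variable x it contains, and into At₀ if it contains
-- none: no existential variable then shares an atom with a universal one, so (c) is
-- vacuous.  This covers monadic sentences, and also ∀x₀ ∀x₁. P(x₀,x₀) ∧ P(x₁,x₁),
-- which is neither an Ackermann nor a monadic sentence.
module Submission where

open import Defs
open import Data.Nat.Properties using (_≟_; <⇒≱; ≮⇒≥)
open import Data.Bool using (true)
open import Data.Empty using (⊥-elim)
open import Data.List.Base as List using (List; []; _∷_; _++_)
open import Data.List.Membership.Propositional using (_∈_; find)
open import Data.List.Membership.Propositional.Properties
  using (∈-++⁺ˡ; ∈-++⁺ʳ; ∈-++⁻; ∈-concatMap⁺; ∈-concatMap⁻)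
open import Data.List.Membership.DecPropositional _≟_ using (_∈?_)
open import Data.List.Relation.Binary.Disjoint.Propositional using (Disjoint)
open import Data.List.Relation.Unary.All as All using (All; []; _∷_; all?)
open import Data.List.Relation.Unary.All.Properties using (++⁻ˡ)
open import Data.List.Relation.Unary.AllPairs using ([]; _∷_)
open import Data.List.Relation.Unary.Any as Any using (here; there)
open import Data.List.Relation.Unary.Unique.Propositional using (Unique)
open import Data.List.Relation.Unary.Unique.DecPropositional _≟_ using (unique?)
open import Data.Maybe using (Maybe; just; nothing)
open import Data.Nat using (_<_; _<?_)
open import Data.Product using (Σ; _×_; _,_; proj₁; proj₂)
open import Data.Sum using (inj₁; inj₂)
open import Data.Unit using (tt)
open import Data.Vec using ([]; _∷_)
open import Function using (_∘_; const)
open import Relation.Nullary using (¬_; yes; no)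
open import Relation.Nullary.Decidable using (from-yes)
open import Relation.Unary using (Pred; Decidable)
open import Relation.Binary.PropositionalEquality using (_≡_; refl; sym; cong; subst)

Unique-++⁻ : ∀ {A : Set} (xs : List A) {ys} →
             Unique (xs ++ ys) → Unique xs × Unique ys × Disjoint xs ys
Unique-++⁻ []       u          = [] , u , λ ()
Unique-++⁻ (x ∷ xs) (x∉ ∷ u) with Unique-++⁻ xs u
... | uxs , uys , xs#ys = ++⁻ˡ xs x∉ ∷ uxs , uys , λ
  { (here refl , v∈ys)  → All.lookup x∉ (∈-++⁺ʳ xs v∈ys) refl
  ; (there v∈xs , v∈ys) → xs#ys (v∈xs , v∈ys) }

module _ {a p} {A : Set a} {P : Pred A p} (P? : Decidable P) where

  find-just : ∀ xs {x} → List.find P? xs ≡ just x → P x × x ∈ xs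
  find-just (y ∷ ys) eq with P? y
  find-just (y ∷ ys) refl | yes py = py , here refl
  ... | no _ = let px , x∈ys = find-just ys eq in px , there x∈ys

  find-nothing : ∀ xs {x} → List.find P? xs ≡ nothing → x ∈ xs → ¬ P x
  find-nothing (y ∷ ys) eq x∈ with P? y | x∈
  find-nothing (y ∷ ys) () x∈ | yes _ | _
  ... | no ¬py | here refl  = ¬py
  ... | no _   | there x∈ys = find-nothing ys eq x∈ys

univVars⊆boundVars : ∀ pre {v} → v ∈ univVars pre → v ∈ boundVars pre
univVars⊆boundVars pre =
  ∈-concatMap⁺ (λ b → proj₁ b ++ proj₂ b) {pre} ∘ Any.map ∈-++⁺ˡ ∘ ∈-concatMap⁻ proj₁ {pre}

existVars⊆boundVars : ∀ pre {v} → v ∈ existVars pre → v ∈ boundVars pre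
existVars⊆boundVars pre =
  ∈-concatMap⁺ (λ b → proj₁ b ++ proj₂ b) {pre} ∘ Any.map (∈-++⁺ʳ _) ∘ ∈-concatMap⁻ proj₂ {pre}

univVars#existVars : ∀ pre → Unique (boundVars pre) → Disjoint (univVars pre) (existVars pre)
univVars#existVars ((xs , ys) ∷ bs) u (v∈X , v∈Y)
  with Unique-++⁻ (xs ++ ys) u
... | uxys , ubs , block#bs with ∈-++⁻ xs v∈X | ∈-++⁻ ys v∈Y
... | inj₁ v∈xs | inj₁ v∈ys = proj₂ (proj₂ (Unique-++⁻ xs uxys)) (v∈xs , v∈ys)
... | inj₁ v∈xs | inj₂ v∈Y′ = block#bs (∈-++⁺ˡ v∈xs , existVars⊆boundVars bs v∈Y′)
... | inj₂ v∈X′ | inj₁ v∈ys = block#bs (∈-++⁺ʳ xs v∈ys , univVars⊆boundVars bs v∈X′)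
... | inj₂ v∈X′ | inj₂ v∈Y′ = univVars#existVars bs ubs (v∈X′ , v∈Y′)

universal-occurs : ∀ {x} φ → StandardForm φ → x ∈ univVars (Sentence.prefix φ) →
                   Σ Atom λ a → a ∈ atoms (Sentence.matrix φ) × x ∈ atomVars a
universal-occurs (sentence pre ψ) (_ , _ , occurs , _) =
  find ∘ ∈-concatMap⁻ atomVars ∘ All.lookup occurs ∘ univVars⊆boundVars pre

singleUniversal⇒GAF : ∀ {x} φ → StandardForm φ → univVars (Sentence.prefix φ) ≡ x ∷ [] → GAF φ
singleUniversal⇒GAF {x} φ@(sentence pre ψ) sf X≡[x] =
  sf , f , (λ { _ _ _ refl → x∈X }) , (λ { _ (_ , _ , () , _) }) , condB , condC
  where
  f : Atom → Maybe Var
  f = const (just x)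

  only-x : ∀ {v} → v ∈ univVars pre → v ≡ x
  only-x v∈X with subst (_ ∈_) X≡[x] v∈X
  ... | here v≡x = v≡x

  x∈X : x ∈ univVars pre
  x∈X = subst (x ∈_) (sym X≡[x]) (here refl)

  condB : CondB φ f
  condB x′ x′∈X with only-x x′∈X
  ... | refl = let a , a∈ψ , x∈a = universal-occurs φ sf x∈X
               in (a , a∈ψ , refl , x∈a) , λ _ _ → only-x

  c1 : ∀ {y} → idx pre y < idx pre x → C1 φ f y
  c1 y<x x′ x′∈X _ with only-x x′∈X
  ... | refl = y<x

  not-c2 : ∀ {y} → idx pre y < idx pre x → ¬ C2 φ f y
  not-c2 y<x (x′ , x′∈X , _ , _ , _ , x′≤y) with only-x x′∈X
  ... | refl = <⇒≱ y<x x′≤y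

  condC : CondC φ f
  condC y _ (x′ , x′∈X , y∈Atₓ) with only-x x′∈X | idx pre y <? idx pre x
  ... | refl | yes y<x = inj₁ (c1 y<x) , λ (_ , c2) → not-c2 y<x c2
  ... | refl | no  y≮x =
    inj₂ (x , x∈X , y∈Atₓ , (λ _ x″∈X _ → only-x x″∈X) , (λ { (_ , _ , () , _) }) , ≮⇒≥ y≮x) ,
    λ (c1 , _) → y≮x (c1 x x∈X y∈Atₓ)

ackermann⇒singleUniversal : ∀ φ → Ackermann φ → Σ Var λ x → univVars (Sentence.prefix φ) ≡ x ∷ []
ackermann⇒singleUniversal _ (_ , x , _ , inj₁ refl) = x , refl
ackermann⇒singleUniversal _ (_ , x , _ , inj₂ refl) = x , refl

AtMostOneVariable : Atom → Set
AtMostOneVariable a = ∀ {v w} → v ∈ atomVars a → w ∈ atomVars a → v ≡ w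

atMostOneVariable⇒GAF : ∀ φ → StandardForm φ → All AtMostOneVariable (atoms (Sentence.matrix φ)) → GAF φ
atMostOneVariable⇒GAF φ@(sentence pre ψ) sf@(_ , unique , _ , _) oneVar =
  sf , f , labels , condA , condB , condC
  where
  f : Atom → Maybe Var
  f a = List.find (_∈? univVars pre) (atomVars a)

  labels : LabelsOK φ f
  labels a _ _ fa≡x = proj₁ (find-just _ (atomVars a) fa≡x)

  condA : CondA φ f
  condA _ (a , _ , fa≡nothing , v∈a) = find-nothing _ (atomVars a) fa≡nothing v∈a

  labelled : ∀ {x a} → a ∈ atoms ψ → x ∈ univVars pre → x ∈ atomVars a → f a ≡ just x
  labelled {a = a} a∈ψ x∈X x∈a with f a in fa
  ... | nothing = ⊥-elim (find-nothing _ (atomVars a) fa x∈a x∈X)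
  ... | just x′ = cong just (All.lookup oneVar a∈ψ (proj₂ (find-just _ (atomVars a) fa)) x∈a)

  condB : CondB φ f
  condB x x∈X with universal-occurs φ sf x∈X
  ... | a , a∈ψ , x∈a =
    (a , a∈ψ , labelled a∈ψ x∈X x∈a , x∈a) ,
    λ { _ (b , b∈ψ , fb≡x , v∈b) _ → All.lookup oneVar b∈ψ v∈b (proj₂ (find-just _ (atomVars b) fb≡x)) }

  condC : CondC φ f
  condC y y∈Y (x , x∈X , (a , a∈ψ , fa≡x , y∈a)) =
    ⊥-elim (univVars#existVars pre unique (subst (_∈ univVars pre) (sym y≡x) x∈X , y∈Y))
    where
    y≡x = All.lookup oneVar a∈ψ y∈a (proj₂ (find-just _ (atomVars a) fa≡x))

unary⇒atMostOneVariable : ∀ a → PredSym.arity (Atom.sym a) ≡ 1 → AtMostOneVariable a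
unary⇒atMostOneVariable (atom (pred _ .1) (var _ ∷ [])) refl (here refl) (here refl) = refl
unary⇒atMostOneVariable (atom (pred _ .1) (cst _ ∷ [])) refl ()

diagonalAtom : Var → Atom
diagonalAtom x = atom (pred 0 2) (var x ∷ var x ∷ [])

diagonalAtom-atMostOneVariable : ∀ x → AtMostOneVariable (diagonalAtom x)
diagonalAtom-atMostOneVariable x v∈ w∈ with v∈ | w∈
... | here refl         | here refl         = refl
... | here refl         | there (here refl) = refl
... | there (here refl) | here refl         = refl
... | there (here refl) | there (here refl) = refl

diagonalExample : Sentence
diagonalExample =
  sentence ((0 ∷ 1 ∷ [] , []) ∷ []) (lit true (diagonalAtom 0) ∧ᶠ lit true (diagonalAtom 1))

diagonalExample-standardForm : StandardForm diagonalExample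
diagonalExample-standardForm =
  tt , from-yes (unique? (boundVars prefix)) ,
  from-yes (all? (_∈? qfVars matrix) (boundVars prefix)) ,
  from-yes (all? (_∈? boundVars prefix) (qfVars matrix))
  where open Sentence diagonalExample

proposition3 :
    ((φ : Sentence) → StandardForm φ → Ackermann φ → GAF φ) ×
    ((φ : Sentence) → StandardForm φ → Monadic φ → GAF φ) ×
    (Σ Sentence λ φ → GAF φ × ¬ Ackermann φ × ¬ Monadic φ)
proposition3 =
  (λ φ sf ack → let _ , X≡[x] = ackermann⇒singleUniversal φ ack in singleUniversal⇒GAF φ sf X≡[x]) ,
  (λ φ sf mon → atMostOneVariable⇒GAF φ sf (All.map (λ {a} → unary⇒atMostOneVariable a) mon)) ,
  diagonalExample ,
  atMostOneVariable⇒GAF diagonalExample diagonalExample-standardForm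
    (diagonalAtom-atMostOneVariable 0 ∷ diagonalAtom-atMostOneVariable 1 ∷ []) ,
  (λ { (_ , _ , _ , inj₁ ()) ; (_ , _ , _ , inj₂ ()) }) ,
  (λ { (() ∷ _) })
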